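{- Assume that for every object $X$ of $\mathbf{C}$ a free uniform-iteration algebra $KX$ exists and is stable. Let $f\colon X\to KY+X$ and $g\colon X\to KY$. Then (i) $f^{\langle\dagger}\sqsubseteq f^\dagger\circ\mathrm{fst}$ in $\mathbf{C}(X\times\mathbb{N},KY)$, and (ii) if $f^{\langle\dagger}\sqsubseteq g\circ\mathrm{fst}$, then $f^\dagger\sqsubseteq g$.
   Context: $\mathbf{C}$ is an extensive category with finite products, a stable natural number object $(\mathbb{N},o,s)$ (supporting primitive recursion) and exponentials $X^{\mathbb{N}}$. A uniform-iteration algebra is an object $A$ with an operator $f\mapsto f^\dagger$ ($f\colon Z\to A+Z$, $f^\dagger\colon Z\to A$) satisfying (Fixpoint) $f^\dagger=[\mathrm{id},f^\dagger]f$ and (Uniformity) $(\mathrm{id}+h)f=gh\Rightarrow f^\dagger=g^\dagger h$; morphisms $h$ satisfy $hf^\dagger=((h+\mathrm{id})f)^\dagger$. $KX$ with unit $\eta$ is free on $X$; $KY$ is stable if for every $X$, $\mathrm{fst}\colon X\times KY\to X$ with $\mathrm{id}\times\eta$ is a free uniform-iteration algebra over $\mathrm{fst}\colon X\times Y\to X$ in $\mathbf{C}/X$. $\mathbb{K}$ has unit $\eta$ and Kleisli lifting $f^*$ the unique algebra morphism with $f^*\eta=f$; strength $\tau$ is the unique morphism with $\tau(\mathrm{id}\times\eta)=\eta$ and $\tau(\mathrm{id}\times h^\dagger)=((\tau+\mathrm{id})\mathrm{dstr}(\mathrm{id}\times h))^\dagger$. For $f\colon X\to KY$, $g\colon X\to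 KZ$: $f\downharpoonright g=\mathrm{fst}^*\tau\langle f,g\rangle$; $f\sqsubseteq f'$ iff $f=f'\downharpoonright f$. The divergence constant is $\bot=(\mathrm{inr}\colon1\to KY+1)^\dagger\colon1\to KY$. Bounded iteration: for $f\colon X\to KY+X$, $f^{\langle\dagger}\colon X\times\mathbb{N}\to KY$ is defined by primitive recursion: $f^{\langle\dagger}(x,o)=\bot$ and $f^{\langle\dagger}(x,s\,n)=a$ if $f(x)=\mathrm{inl}\,a$, $=f^{\langle\dagger}(y,n)$ if $f(x)=\mathrm{inr}\,y$ (i.e. $f^{\langle\dagger}(\mathrm{id}\times s)=[\mathrm{fst},f^{\langle\dagger}]\,\mathrm{dstl}\,(f\times\mathrm{id})$). -}

module Defs where

open import Level using (Level; _⊔_; suc)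
open import Data.Product using (Σ; Σ-syntax; proj₁; proj₂) renaming (_×_ to _∧_; _,_ to _,,_)
open import Relation.Binary.PropositionalEquality
open ≡-Reasoning

record Category (o h : Level) : Set (suc (o ⊔ h)) where
  infixr 9 _∘_
  field
    Obj : Set o
    Hom : Obj → Obj → Set h
    id  : ∀ {A} → Hom A A
    _∘_ : ∀ {A B D} → Hom B D → Hom A B → Hom A D
    identityˡ : ∀ {A B} {f : Hom A B} → id ∘ f ≡ f
    identityʳ : ∀ {A B} {f : Hom A B} → f ∘ id ≡ f
    assoc : ∀ {A B D E} {f : Hom A B} {g : Hom B D} {k : Hom D E} →
            (k ∘ g) ∘ f ≡ k ∘ (g ∘ f)

module _ {o h : Level} (C : Category o h) where
  open Category C

  -- (p1 , p2) is a pullback of (f , g)  (commutativity stated separately)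
  IsPullback : ∀ {P A B D} (f : Hom A D) (g : Hom B D) (p1 : Hom P A) (p2 : Hom P B) → Set (o ⊔ h)
  IsPullback {P} {A} {B} f g p1 p2 =
    ∀ {Q} (q1 : Hom Q A) (q2 : Hom Q B) → f ∘ q1 ≡ g ∘ q2 →
    Σ[ u ∈ Hom Q P ] ((p1 ∘ u ≡ q1 ∧ p2 ∘ u ≡ q2) ∧
                      (∀ v → p1 ∘ v ≡ q1 → p2 ∘ v ≡ q2 → v ≡ u))

  IsCoproductCocone : ∀ {X1 X2 X} (m1 : Hom X1 X) (m2 : Hom X2 X) → Set (o ⊔ h)
  IsCoproductCocone {X1} {X2} {X} m1 m2 =
    ∀ {Q} (f1 : Hom X1 Q) (f2 : Hom X2 Q) →
    Σ[ u ∈ Hom X Q ] ((u ∘ m1 ≡ f1 ∧ u ∘ m2 ≡ f2) ∧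
                      (∀ v → v ∘ m1 ≡ f1 → v ∘ m2 ≡ f2 → v ≡ u))

  record Products : Set (o ⊔ h) where
    infixr 7 _×_
    field
      𝟙 : Obj
      ! : ∀ {A} → Hom A 𝟙
      !-unique : ∀ {A} (f : Hom A 𝟙) → f ≡ !
      _×_ : Obj → Obj → Obj
      fst : ∀ {A B} → Hom (A × B) A
      snd : ∀ {A B} → Hom (A × B) B
      ⟨_,_⟩ : ∀ {A B D} → Hom D A → Hom D B → Hom D (A × B)
      fst-β : ∀ {A B D} {f : Hom D A} {g : Hom D B} → fst ∘ ⟨ f , g ⟩ ≡ f
      snd-β : ∀ {A B D} {f : Hom D A} {g : Hom D B} → snd ∘ ⟨ f , g ⟩ ≡ g
      ⟨⟩-unique : ∀ {A B D} {f : Hom D A} {g : Hom D B} (k : Hom D (A × B)) →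
                  fst ∘ k ≡ f → snd ∘ k ≡ g → k ≡ ⟨ f , g ⟩
    infixr 7 _×₁_
    _×₁_ : ∀ {A B A' B'} → Hom A A' → Hom B B' → Hom (A × B) (A' × B')
    f ×₁ g = ⟨ f ∘ fst , g ∘ snd ⟩

  record Coproducts : Set (o ⊔ h) where
    infixr 6 _+_
    field
      𝟘 : Obj
      ¡ : ∀ {A} → Hom 𝟘 A
      ¡-unique : ∀ {A} (f : Hom 𝟘 A) → f ≡ ¡
      _+_ : Obj → Obj → Obj
      inl : ∀ {A B} → Hom A (A + B)
      inr : ∀ {A B} → Hom B (A + B)
      [_,_] : ∀ {A B D} → Hom A D → Hom B D → Hom (A + B) D
      inl-β : ∀ {A B D} {f : Hom A D} {g : Hom B D} → [ f , g ] ∘ inl ≡ f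
      inr-β : ∀ {A B D} {f : Hom A D} {g : Hom B D} → [ f , g ] ∘ inr ≡ g
      []-unique : ∀ {A B D} {f : Hom A D} {g : Hom B D} (k : Hom (A + B) D) →
                  k ∘ inl ≡ f → k ∘ inr ≡ g → k ≡ [ f , g ]
    infixr 6 _+₁_
    _+₁_ : ∀ {A B A' B'} → Hom A A' → Hom B B' → Hom (A + B) (A' + B')
    f +₁ g = [ inl ∘ f , inr ∘ g ]

  -- Extensivity (Carboni–Lack–Walters, Prop. 2.2): pullbacks along coproduct
  -- injections exist, and in every commutative diagram
  --    X1 --m1--> X <--m2-- X2
  --    |f1        |k        |f2
  --    A  --inl-> A+B <-inr-- B
  -- the top row is a coproduct iff both squares are pullbacks.
  record IsExtensive (Cp : Coproducts) : Set (o ⊔ h) where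
    open Coproducts Cp
    field
      pullback-inl : ∀ {X A B} (k : Hom X (A + B)) →
        Σ[ P ∈ Obj ] Σ[ p1 ∈ Hom P X ] Σ[ p2 ∈ Hom P A ]
          (k ∘ p1 ≡ inl ∘ p2 ∧ IsPullback k inl p1 p2)
      pullback-inr : ∀ {X A B} (k : Hom X (A + B)) →
        Σ[ P ∈ Obj ] Σ[ p1 ∈ Hom P X ] Σ[ p2 ∈ Hom P B ]
          (k ∘ p1 ≡ inr ∘ p2 ∧ IsPullback k inr p1 p2)
      coproduct⇔pullbacks : ∀ {X1 X2 X A B}
        (m1 : Hom X1 X) (m2 : Hom X2 X) (k : Hom X (A + B))
        (f1 : Hom X1 A) (f2 : Hom X2 B) →
        k ∘ m1 ≡ inl ∘ f1 → k ∘ m2 ≡ inr ∘ f2 →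
        (IsCoproductCocone m1 m2 → (IsPullback k inl m1 f1 ∧ IsPullback k inr m2 f2)) ∧
        ((IsPullback k inl m1 f1 ∧ IsPullback k inr m2 f2) → IsCoproductCocone m1 m2)

  record StableNNO (P : Products) : Set (o ⊔ h) where
    open Products P
    field
      ℕ : Obj
      zero : Hom 𝟙 ℕ
      succ : Hom ℕ ℕ
      rec : ∀ {X A} → Hom X A → Hom A A → Hom (X × ℕ) A
      rec-zero : ∀ {X A} {a : Hom X A} {t : Hom A A} → rec a t ∘ ⟨ id , zero ∘ ! ⟩ ≡ a
      rec-succ : ∀ {X A} {a : Hom X A} {t : Hom A A} → rec a t ∘ (id ×₁ succ) ≡ t ∘ rec a t
      rec-unique : ∀ {X A} {a : Hom X A} {t : Hom A A} (r : Hom (X × ℕ) A) →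
        r ∘ ⟨ id , zero ∘ ! ⟩ ≡ a → r ∘ (id ×₁ succ) ≡ t ∘ r → r ≡ rec a t

  record ExponentialsOf (P : Products) (N : Obj) : Set (o ⊔ h) where
    open Products P
    field
      _^N : Obj → Obj
      eval : ∀ {A} → Hom ((A ^N) × N) A
      curry : ∀ {Z A} → Hom (Z × N) A → Hom Z (A ^N)
      curry-β : ∀ {Z A} {f : Hom (Z × N) A} → eval ∘ (curry f ×₁ id) ≡ f
      curry-unique : ∀ {Z A} {f : Hom (Z × N) A} (k : Hom Z (A ^N)) →
        eval ∘ (k ×₁ id) ≡ f → k ≡ curry f

record Standing {o h : Level} (C : Category o h) : Set (o ⊔ h) where
  field
    products : Products C
    coproducts : Coproducts C
    extensive : IsExtensive C coproducts
    nno : StableNNO C products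
    exponentials : ExponentialsOf C products (StableNNO.ℕ nno)

module Theory {o h : Level} {C : Category o h} (S : Standing C) where
  open Category C public
  open Standing S
  open Products products public
  open Coproducts coproducts public
  open IsExtensive extensive
  open StableNNO nno public
  open ExponentialsOf exponentials public

  ⟨⟩-η : ∀ {A B D} {k : Hom D (A × B)} → ⟨ fst ∘ k , snd ∘ k ⟩ ≡ k
  ⟨⟩-η {k = k} = sym (⟨⟩-unique k refl refl)

  ⟨⟩-∘ : ∀ {A B D E} {f : Hom D A} {g : Hom D B} {k : Hom E D} →
         ⟨ f , g ⟩ ∘ k ≡ ⟨ f ∘ k , g ∘ k ⟩
  ⟨⟩-∘ {f = f} {g} {k} = ⟨⟩-unique _
    (trans (sym assoc) (cong (_∘ k) fst-β))
    (trans (sym assoc) (cong (_∘ k) snd-β))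

  ×₁-⟨⟩ : ∀ {A B A' B' D} {f : Hom A A'} {g : Hom B B'} {a : Hom D A} {b : Hom D B} →
          (f ×₁ g) ∘ ⟨ a , b ⟩ ≡ ⟨ f ∘ a , g ∘ b ⟩
  ×₁-⟨⟩ {f = f} {g} {a} {b} = begin
    ⟨ f ∘ fst , g ∘ snd ⟩ ∘ ⟨ a , b ⟩ ≡⟨ ⟨⟩-∘ ⟩
    ⟨ (f ∘ fst) ∘ ⟨ a , b ⟩ , (g ∘ snd) ∘ ⟨ a , b ⟩ ⟩
      ≡⟨ cong₂ ⟨_,_⟩ (trans assoc (cong (f ∘_) fst-β)) (trans assoc (cong (g ∘_) snd-β)) ⟩
    ⟨ f ∘ a , g ∘ b ⟩ ∎

  fst-×₁ : ∀ {A B A' B'} {f : Hom A A'} {g : Hom B B'} → fst ∘ (f ×₁ g) ≡ f ∘ fst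
  fst-×₁ = fst-β

  snd-×₁ : ∀ {A B A' B'} {f : Hom A A'} {g : Hom B B'} → snd ∘ (f ×₁ g) ≡ g ∘ snd
  snd-×₁ = snd-β

  []-∘ : ∀ {A B D E} {f : Hom A D} {g : Hom B D} {k : Hom D E} →
         k ∘ [ f , g ] ≡ [ k ∘ f , k ∘ g ]
  []-∘ {f = f} {g} {k} = []-unique _
    (trans assoc (cong (k ∘_) inl-β))
    (trans assoc (cong (k ∘_) inr-β))

  []-+₁ : ∀ {A B A' B' D} {f : Hom A' D} {g : Hom B' D} {a : Hom A A'} {b : Hom B B'} →
          [ f , g ] ∘ (a +₁ b) ≡ [ f ∘ a , g ∘ b ]
  []-+₁ {f = f} {g} {a} {b} = begin
    [ f , g ] ∘ [ inl ∘ a , inr ∘ b ] ≡⟨ []-∘ ⟩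
    [ [ f , g ] ∘ (inl ∘ a) , [ f , g ] ∘ (inr ∘ b) ]
      ≡⟨ cong₂ [_,_] (trans (sym assoc) (cong (_∘ a) inl-β)) (trans (sym assoc) (cong (_∘ b) inr-β)) ⟩
    [ f ∘ a , g ∘ b ] ∎

  +₁-∘ : ∀ {A B A' B' A'' B''} {a : Hom A' A''} {b : Hom B' B''} {c : Hom A A'} {d : Hom B B'} →
         (a +₁ b) ∘ (c +₁ d) ≡ (a ∘ c) +₁ (b ∘ d)
  +₁-∘ = trans []-+₁ (cong₂ [_,_] assoc assoc)

  private
    pbR1 : ∀ {A B D} → IsPullback C (snd {A} {B + D}) inl (id ×₁ inl) snd
    pbR1 q1 q2 e =
      ⟨ fst ∘ q1 , q2 ⟩ ,,
      ((trans ×₁-⟨⟩ (trans (cong₂ ⟨_,_⟩ identityˡ (sym e)) ⟨⟩-η) ,, snd-β) ,,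
       λ v e1 e2 → ⟨⟩-unique v
         (trans (cong (_∘ v) (sym (trans fst-×₁ identityˡ)))
           (trans assoc (cong (fst ∘_) e1))) e2)
    pbR2 : ∀ {A B D} → IsPullback C (snd {A} {B + D}) inr (id ×₁ inr) snd
    pbR2 q1 q2 e =
      ⟨ fst ∘ q1 , q2 ⟩ ,,
      ((trans ×₁-⟨⟩ (trans (cong₂ ⟨_,_⟩ identityˡ (sym e)) ⟨⟩-η) ,, snd-β) ,,
       λ v e1 e2 → ⟨⟩-unique v
         (trans (cong (_∘ v) (sym (trans fst-×₁ identityˡ)))
           (trans assoc (cong (fst ∘_) e1))) e2)
    pbL1 : ∀ {A B D} → IsPullback C (fst {A + B} {D}) inl (inl ×₁ id) fst
    pbL1 q1 q2 e =
      ⟨ q2 , snd ∘ q1 ⟩ ,,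
      ((trans ×₁-⟨⟩ (trans (cong₂ ⟨_,_⟩ (sym e) identityˡ) ⟨⟩-η) ,, fst-β) ,,
       λ v e1 e2 → ⟨⟩-unique v e2
         (trans (cong (_∘ v) (sym (trans snd-×₁ identityˡ)))
           (trans assoc (cong (snd ∘_) e1))))
    pbL2 : ∀ {A B D} → IsPullback C (fst {A + B} {D}) inr (inr ×₁ id) fst
    pbL2 q1 q2 e =
      ⟨ q2 , snd ∘ q1 ⟩ ,,
      ((trans ×₁-⟨⟩ (trans (cong₂ ⟨_,_⟩ (sym e) identityˡ) ⟨⟩-η) ,, fst-β) ,,
       λ v e1 e2 → ⟨⟩-unique v e2
         (trans (cong (_∘ v) (sym (trans snd-×₁ identityˡ)))
           (trans assoc (cong (snd ∘_) e1))))

  -- dstr : A × (B + D) → A × B + A × D, the inverse of [ id ×₁ inl , id ×₁ inr ]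
  dstr : ∀ {A B D} → Hom (A × (B + D)) (A × B + A × D)
  dstr {A} {B} {D} = proj₁
    (proj₂ (coproduct⇔pullbacks (id ×₁ inl) (id ×₁ inr) snd snd snd snd-β snd-β)
       (pbR1 ,, pbR2) inl inr)

  -- dstl : (A + B) × D → A × D + B × D, the inverse of [ inl ×₁ id , inr ×₁ id ]
  dstl : ∀ {A B D} → Hom ((A + B) × D) (A × D + B × D)
  dstl {A} {B} {D} = proj₁
    (proj₂ (coproduct⇔pullbacks (inl ×₁ id) (inr ×₁ id) fst fst fst fst-β fst-β)
       (pbL1 ,, pbL2) inl inr)

  record IterAlg (A : Obj) : Set (o ⊔ h) where
    field
      _† : ∀ {Z} → Hom Z (A + Z) → Hom Z A
      fixpoint : ∀ {Z} (f : Hom Z (A + Z)) → f † ≡ [ id , f † ] ∘ f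
      uniformity : ∀ {Z W} (f : Hom Z (A + Z)) (g : Hom W (A + W)) (k : Hom Z W) →
        (id +₁ k) ∘ f ≡ g ∘ k → f † ≡ (g †) ∘ k

  IsIterMorph : ∀ {A B} → IterAlg A → IterAlg B → Hom A B → Set (o ⊔ h)
  IsIterMorph {A} {B} a b k =
    ∀ {Z} (f : Hom Z (A + Z)) → k ∘ IterAlg._† a f ≡ IterAlg._† b ((k +₁ id) ∘ f)

  record FreeIterAlg (X : Obj) : Set (o ⊔ h) where
    field
      K : Obj
      η : Hom X K
      alg : IterAlg K
      lift : ∀ {B} (b : IterAlg B) (k : Hom X B) → Hom K B
      lift-morph : ∀ {B} (b : IterAlg B) (k : Hom X B) → IsIterMorph alg b (lift b k)
      lift-η : ∀ {B} (b : IterAlg B) (k : Hom X B) → lift b k ∘ η ≡ k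
      lift-unique : ∀ {B} (b : IterAlg B) (k : Hom X B) (k' : Hom K B) →
        IsIterMorph alg b k' → k' ∘ η ≡ k → k' ≡ lift b k

  -- uniform-iteration algebras in the slice C/X, on an object (B , b : B → X).
  -- Coproducts in C/X are those of C; f : (Z,p) → (B,b)+(Z,p) in C/X means [ b , p ] ∘ f ≡ p.
  record SliceIterAlg (X B : Obj) (b : Hom B X) : Set (o ⊔ h) where
    field
      ‡ : ∀ {Z} (p : Hom Z X) (f : Hom Z (B + Z)) → [ b , p ] ∘ f ≡ p → Hom Z B
      ‡-over : ∀ {Z} (p : Hom Z X) (f : Hom Z (B + Z)) (e : [ b , p ] ∘ f ≡ p) →
        b ∘ ‡ p f e ≡ p
      fixpoint : ∀ {Z} (p : Hom Z X) (f : Hom Z (B + Z)) (e : [ b , p ] ∘ f ≡ p) →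
        ‡ p f e ≡ [ id , ‡ p f e ] ∘ f
      uniformity : ∀ {Z W} (p : Hom Z X) (q : Hom W X)
        (f : Hom Z (B + Z)) (g : Hom W (B + W))
        (e : [ b , p ] ∘ f ≡ p) (e' : [ b , q ] ∘ g ≡ q) (k : Hom Z W) →
        q ∘ k ≡ p → (id +₁ k) ∘ f ≡ g ∘ k → ‡ p f e ≡ ‡ q g e' ∘ k

  IsSliceMorph : ∀ {X B B'} {b : Hom B X} {b' : Hom B' X} →
    SliceIterAlg X B b → SliceIterAlg X B' b' → Hom B B' → Set (o ⊔ h)
  IsSliceMorph {X} {B} {B'} {b} {b'} S S' k =
    b' ∘ k ≡ b ∧
    (∀ {Z} (p : Hom Z X) (f : Hom Z (B + Z)) (e : [ b , p ] ∘ f ≡ p)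
       (e' : [ b' , p ] ∘ ((k +₁ id) ∘ f) ≡ p) →
       k ∘ SliceIterAlg.‡ S p f e ≡ SliceIterAlg.‡ S' p ((k +₁ id) ∘ f) e')

  canonSlice : ∀ (X : Obj) {A} → IterAlg A → SliceIterAlg X (X × A) fst
  canonSlice X {A} a = record
    { ‡ = λ p f e → ⟨ p , ((snd +₁ id) ∘ f) † ⟩
    ; ‡-over = λ p f e → fst-β
    ; fixpoint = fix
    ; uniformity = unif
    }
    where
    open IterAlg a
    fix : ∀ {Z} (p : Hom Z X) (f : Hom Z ((X × A) + Z)) (e : [ fst , p ] ∘ f ≡ p) →
          ⟨ p , ((snd +₁ id) ∘ f) † ⟩ ≡ [ id , ⟨ p , ((snd +₁ id) ∘ f) † ⟩ ] ∘ f
    fix p f e = sym (⟨⟩-unique _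
      (begin
        fst ∘ ([ id , u ] ∘ f) ≡⟨ sym assoc ⟩
        (fst ∘ [ id , u ]) ∘ f ≡⟨ cong (_∘ f) []-∘ ⟩
        [ fst ∘ id , fst ∘ u ] ∘ f ≡⟨ cong (λ z → z ∘ f) (cong₂ [_,_] identityʳ fst-β) ⟩
        [ fst , p ] ∘ f ≡⟨ e ⟩
        p ∎)
      (begin
        snd ∘ ([ id , u ] ∘ f) ≡⟨ sym assoc ⟩
        (snd ∘ [ id , u ]) ∘ f ≡⟨ cong (_∘ f) []-∘ ⟩
        [ snd ∘ id , snd ∘ u ] ∘ f ≡⟨ cong (λ z → z ∘ f) (cong₂ [_,_] identityʳ snd-β) ⟩
        [ snd , F † ] ∘ f ≡⟨ cong (_∘ f) (sym (trans []-+₁ (cong₂ [_,_] identityˡ identityʳ))) ⟩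
        ([ id , F † ] ∘ (snd +₁ id)) ∘ f ≡⟨ assoc ⟩
        [ id , F † ] ∘ F ≡⟨ sym (fixpoint F) ⟩
        F † ∎))
      where
      F = (snd +₁ id) ∘ f
      u = ⟨ p , F † ⟩
    unif : ∀ {Z W} (p : Hom Z X) (q : Hom W X) (f : Hom Z ((X × A) + Z)) (g : Hom W ((X × A) + W))
      (e : [ fst , p ] ∘ f ≡ p) (e' : [ fst , q ] ∘ g ≡ q) (k : Hom Z W) →
      q ∘ k ≡ p → (id +₁ k) ∘ f ≡ g ∘ k →
      ⟨ p , ((snd +₁ id) ∘ f) † ⟩ ≡ ⟨ q , ((snd +₁ id) ∘ g) † ⟩ ∘ k
    unif p q f g e e' k qk fk = sym (trans ⟨⟩-∘ (cong₂ ⟨_,_⟩ qk (sym (uniformity _ _ k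
      (begin
        (id +₁ k) ∘ ((snd +₁ id) ∘ f) ≡⟨ sym assoc ⟩
        ((id +₁ k) ∘ (snd +₁ id)) ∘ f ≡⟨ cong (_∘ f) (trans +₁-∘ (trans (cong₂ _+₁_ (trans identityˡ (sym identityʳ)) (trans identityʳ (sym identityˡ))) (sym +₁-∘))) ⟩
        ((snd +₁ id) ∘ (id +₁ k)) ∘ f ≡⟨ assoc ⟩
        (snd +₁ id) ∘ ((id +₁ k) ∘ f) ≡⟨ cong ((snd +₁ id) ∘_) fk ⟩
        (snd +₁ id) ∘ (g ∘ k) ≡⟨ sym assoc ⟩
        ((snd +₁ id) ∘ g) ∘ k ∎)))))

  -- Stability of a free algebra KY (given as F): for the object X,
  -- fst : X × KY → X (with the canonical slice structure) together with
  -- id ×₁ η : X × Y → X × KY is a free uniform-iteration algebra in C/X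
  -- over fst : X × Y → X.
  record IsStable (X : Obj) {Y : Obj} (F : FreeIterAlg Y) : Set (o ⊔ h) where
    open FreeIterAlg F
    field
      slift : ∀ {B} {b : Hom B X} (T : SliceIterAlg X B b)
        (k : Hom (X × Y) B) → b ∘ k ≡ fst → Hom (X × K) B
      slift-morph : ∀ {B} {b : Hom B X} (T : SliceIterAlg X B b)
        (k : Hom (X × Y) B) (e : b ∘ k ≡ fst) →
        IsSliceMorph (canonSlice X alg) T (slift T k e)
      slift-η : ∀ {B} {b : Hom B X} (T : SliceIterAlg X B b)
        (k : Hom (X × Y) B) (e : b ∘ k ≡ fst) →
        slift T k e ∘ (id ×₁ η) ≡ k
      slift-unique : ∀ {B} {b : Hom B X} (T : SliceIterAlg X B b)
        (k : Hom (X × Y) B) (e : b ∘ k ≡ fst) (k' : Hom (X × K) B) →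
        IsSliceMorph (canonSlice X alg) T k' → k' ∘ (id ×₁ η) ≡ k → k' ≡ slift T k e

  record Hypotheses : Set (o ⊔ h) where
    field
      free : (X : Obj) → FreeIterAlg X
      stable : (X Y : Obj) → IsStable X (free Y)

  module WithHyp (H : Hypotheses) where
    open Hypotheses H

    K : Obj → Obj
    K Y = FreeIterAlg.K (free Y)

    η : ∀ {Y} → Hom Y (K Y)
    η {Y} = FreeIterAlg.η (free Y)

    iter : ∀ Y {Z} → Hom Z (K Y + Z) → Hom Z (K Y)
    iter Y f = IterAlg._† (FreeIterAlg.alg (free Y)) f

    kl : ∀ {X Y} → Hom X (K Y) → Hom (K X) (K Y)
    kl {X} {Y} f = FreeIterAlg.lift (free X) (FreeIterAlg.alg (free Y)) f

    τ : ∀ A B → Hom (A × K B) (K (A × B))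
    τ A B = snd ∘ IsStable.slift (stable A B)
      (canonSlice A (FreeIterAlg.alg (free (A × B)))) ⟨ fst , η ⟩ fst-β

    restr : ∀ {X} Y Z → Hom X (K Y) → Hom X (K Z) → Hom X (K Y)
    restr Y Z f g = kl (fst {K Y} {Z}) ∘ (τ (K Y) Z ∘ ⟨ f , g ⟩)

    -- f ⊑ f'  iff  f = f' ↓ f   (written  Below Y f f')
    Below : ∀ {X} Y → Hom X (K Y) → Hom X (K Y) → Set h
    Below Y f f' = f ≡ restr Y Y f' f

    diverge : ∀ Y → Hom 𝟙 (K Y)
    diverge Y = iter Y inr

    -- b is the bounded iterate f^{⟨†} : X × ℕ → KY of f : X → KY + X, i.e. the
    -- morphism defined by primitive recursion through
    --   f^{⟨†} ∘ (id × o) = ⊥ ∘ !          (with X × 1 ≅ X)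
    --   f^{⟨†} ∘ (id × s) = [ fst , f^{⟨†} ] ∘ dstl ∘ (f × id)
    IsBoundedIter : ∀ {X} Y → Hom X (K Y + X) → Hom (X × ℕ) (K Y) → Set h
    IsBoundedIter Y f b =
      (b ∘ ⟨ id , zero ∘ ! ⟩ ≡ diverge Y ∘ !) ∧
      (b ∘ (id ×₁ succ) ≡ [ fst , b ] ∘ (dstl ∘ (f ×₁ id)))

module Submission where

-- Write state (x , n) = [ inl , f ]ⁿ (inr x) for the state of the iteration of f after n steps.
-- Then f† ∘ fst = [ id , f† ] ∘ state, while the recurrence of the bounded iterate has the
-- unique solution [ id , ⊥ ] ∘ state; so (i) amounts to h ↓ h = h and h ↓ ⊥ = ⊥.
-- For (ii), f† x is the iterate, started at (x , inr x), of the map resuming the computation of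
-- f from a state while remembering x. By uniformity along (x , n) ↦ (x , state (x , n)) the
-- state can be replaced by a step counter; the outputs of the counted iteration are values
-- f^{⟨†}(x , n + 1), which the hypothesis leaves unchanged under restriction by g x. Stability
-- of K Y identifies the iterate whose outputs are restricted by g x with g x ↓ f† x.

open import Defs
open import Level using (Level)
open import Data.Product using (proj₁; proj₂) renaming (_×_ to _∧_; _,_ to _,,_)
open import Relation.Binary.PropositionalEquality
open ≡-Reasoning

module Basics {o ℓ : Level} {C : Category o ℓ} (S : Standing C) where
  open Theory S
  open IsExtensive (Standing.extensive S)

  pullˡ : ∀ {A B D E} {f : Hom D E} {g : Hom B D} {k : Hom A B} {m : Hom B E} →
    f ∘ g ≡ m → f ∘ (g ∘ k) ≡ m ∘ k
  pullˡ {k = k} e = trans (sym assoc) (cong (_∘ k) e)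

  pullʳ : ∀ {A B D E} {f : Hom D E} {g : Hom B D} {k : Hom A B} {m : Hom A D} →
    g ∘ k ≡ m → (f ∘ g) ∘ k ≡ f ∘ m
  pullʳ {f = f} e = trans assoc (cong (f ∘_) e)

  zero!-∘ : ∀ {A B} {k : Hom A B} → (zero ∘ !) ∘ k ≡ zero ∘ !
  zero!-∘ = pullʳ (!-unique _)

  id×zero! : ∀ {A B} → id {A} ×₁ (zero ∘ ! {B}) ≡ ⟨ id , zero ∘ ! ⟩ ∘ fst
  id×zero! = trans (cong ⟨ id ∘ fst ,_⟩ (trans zero!-∘ (sym zero!-∘))) (sym ⟨⟩-∘)

  ×₁-∘ : ∀ {A B A' B' A'' B''} {a : Hom A' A''} {b : Hom B' B''} {c : Hom A A'} {d : Hom B B'} →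
    (a ×₁ b) ∘ (c ×₁ d) ≡ (a ∘ c) ×₁ (b ∘ d)
  ×₁-∘ = trans ×₁-⟨⟩ (cong₂ ⟨_,_⟩ (sym assoc) (sym assoc))

  ×₁-id : ∀ {A B} → id {A} ×₁ id {B} ≡ id
  ×₁-id = sym (⟨⟩-unique id (trans identityʳ (sym identityˡ)) (trans identityʳ (sym identityˡ)))

  first↔second : ∀ {A B A' B'} {a : Hom A A'} {b : Hom B B'} →
    (a ×₁ id) ∘ (id ×₁ b) ≡ (id ×₁ b) ∘ (a ×₁ id)
  first↔second = trans ×₁-∘ (trans (cong₂ _×₁_ (trans identityʳ (sym identityˡ)) (trans identityˡ (sym identityʳ))) (sym ×₁-∘))

  second∘second : ∀ {A B B' B''} {a : Hom B' B''} {b : Hom B B'} →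
    (id {A} ×₁ a) ∘ (id ×₁ b) ≡ id ×₁ (a ∘ b)
  second∘second = trans ×₁-∘ (cong (_×₁ _) identityˡ)

  id×-⟨⟩ : ∀ {A B B' D} {g : Hom B B'} {a : Hom D A} {b : Hom D B} → (id ×₁ g) ∘ ⟨ a , b ⟩ ≡ ⟨ a , g ∘ b ⟩
  id×-⟨⟩ = trans ×₁-⟨⟩ (cong (λ z → ⟨ z , _ ⟩) identityˡ)

  ×id-⟨⟩ : ∀ {A A' B D} {g : Hom A A'} {a : Hom D A} {b : Hom D B} → (g ×₁ id) ∘ ⟨ a , b ⟩ ≡ ⟨ g ∘ a , b ⟩
  ×id-⟨⟩ = trans ×₁-⟨⟩ (cong (λ z → ⟨ _ , z ⟩) identityˡ)

  fst-∘-×₁ : ∀ {A B A' B' D} {x : Hom A' D} {a : Hom A A'} {b : Hom B B'} → (x ∘ fst) ∘ (a ×₁ b) ≡ x ∘ (a ∘ fst)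
  fst-∘-×₁ = pullʳ fst-β

  +₁-id : ∀ {A B} → id {A} +₁ id {B} ≡ id
  +₁-id = sym ([]-unique id (trans identityˡ (sym identityʳ)) (trans identityˡ (sym identityʳ)))

  +₁-swap : ∀ {A B A' B'} {a : Hom A A'} {b : Hom B B'} → (id +₁ b) ∘ (a +₁ id) ≡ (a +₁ id) ∘ (id +₁ b)
  +₁-swap = trans +₁-∘ (trans (cong₂ _+₁_ (trans identityˡ (sym identityʳ)) (trans identityʳ (sym identityˡ))) (sym +₁-∘))

  []-ext : ∀ {A B D} {k k' : Hom (A + B) D} → k ∘ inl ≡ k' ∘ inl → k ∘ inr ≡ k' ∘ inr → k ≡ k'
  []-ext {k = k} {k'} e1 e2 = trans ([]-unique k refl refl) (sym ([]-unique k' (sym e1) (sym e2)))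

  codiag-+₁ : ∀ {A B D} {a : Hom A D} {b : Hom B D} → [ id , id ] ∘ (a +₁ b) ≡ [ a , b ]
  codiag-+₁ = trans []-+₁ (cong₂ [_,_] identityˡ identityˡ)

  module _ {X1 X2 X} {m1 : Hom X1 X} {m2 : Hom X2 X} (cc : IsCoproductCocone C m1 m2) where
    cocone-inl : proj₁ (cc inl inr) ∘ m1 ≡ inl
    cocone-inl = proj₁ (proj₁ (proj₂ (cc inl inr)))

    cocone-inr : proj₁ (cc inl inr) ∘ m2 ≡ inr
    cocone-inr = proj₂ (proj₁ (proj₂ (cc inl inr)))

    cocone-inverse : [ m1 , m2 ] ∘ proj₁ (cc inl inr) ≡ id
    cocone-inverse = trans (proj₂ (proj₂ (cc m1 m2)) _ (trans (pullʳ cocone-inl) inl-β) (trans (pullʳ cocone-inr) inr-β))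
                           (sym (proj₂ (proj₂ (cc m1 m2)) id identityˡ identityˡ))

  split-ext : ∀ {X1 X2 X E} {m1 : Hom X1 X} {m2 : Hom X2 X} {d : Hom X (X1 + X2)} →
    [ m1 , m2 ] ∘ d ≡ id → {u v : Hom X E} → u ∘ m1 ≡ v ∘ m1 → u ∘ m2 ≡ v ∘ m2 → u ≡ v
  split-ext {m1 = m1} {m2} {d} inv {u} {v} e1 e2 = begin
    u                         ≡⟨ expand u ⟩
    [ u ∘ m1 , u ∘ m2 ] ∘ d   ≡⟨ cong (_∘ d) (cong₂ [_,_] e1 e2) ⟩
    [ v ∘ m1 , v ∘ m2 ] ∘ d   ≡⟨ sym (expand v) ⟩
    v                         ∎
    where
    expand : ∀ w → w ≡ [ w ∘ m1 , w ∘ m2 ] ∘ d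
    expand w = trans (sym identityʳ) (trans (cong (w ∘_) (sym inv)) (pullˡ []-∘))

  -- dstr and dstl contain pullback proofs that are private to Defs; stating these facts for an
  -- arbitrary proof P lets unification recover them from dstr and dstl.
  private
    dstr-cocone : ∀ {A B D} P → IsCoproductCocone C (id {A} ×₁ inl {B} {D}) (id ×₁ inr)
    dstr-cocone = proj₂ (coproduct⇔pullbacks (id ×₁ inl) (id ×₁ inr) snd snd snd snd-β snd-β)
    dstr-cocone-inl : ∀ {A B D} P → proj₁ (dstr-cocone {A} {B} {D} P inl inr) ∘ (id ×₁ inl) ≡ inl
    dstr-cocone-inl P = cocone-inl (dstr-cocone P)
    dstr-cocone-inr : ∀ {A B D} P → proj₁ (dstr-cocone {A} {B} {D} P inl inr) ∘ (id ×₁ inr) ≡ inr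
    dstr-cocone-inr P = cocone-inr (dstr-cocone P)
    dstr-cocone-inverse : ∀ {A B D} P → [ id ×₁ inl , id ×₁ inr ] ∘ proj₁ (dstr-cocone {A} {B} {D} P inl inr) ≡ id
    dstr-cocone-inverse P = cocone-inverse (dstr-cocone P)

  dstr-inl : ∀ {A B D} → dstr {A} {B} {D} ∘ (id ×₁ inl) ≡ inl
  dstr-inl = dstr-cocone-inl _

  dstr-inr : ∀ {A B D} → dstr {A} {B} {D} ∘ (id ×₁ inr) ≡ inr
  dstr-inr = dstr-cocone-inr _

  dstr-ext : ∀ {A B D E} {u v : Hom (A × (B + D)) E} →
    u ∘ (id ×₁ inl) ≡ v ∘ (id ×₁ inl) → u ∘ (id ×₁ inr) ≡ v ∘ (id ×₁ inr) → u ≡ v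
  dstr-ext = split-ext {d = dstr} (dstr-cocone-inverse _)

  dstr-natural : ∀ {A B D A' B' D'} {m : Hom (A × (B + D)) (A' × (B' + D'))}
    {p : Hom (A × B) (A' × B')} {q : Hom (A × D) (A' × D')} →
    m ∘ (id ×₁ inl) ≡ (id ×₁ inl) ∘ p → m ∘ (id ×₁ inr) ≡ (id ×₁ inr) ∘ q →
    dstr ∘ m ≡ (p +₁ q) ∘ dstr
  dstr-natural e1 e2 = dstr-ext
    (trans (pullʳ e1) (trans (pullˡ dstr-inl) (sym (trans (pullʳ dstr-inl) inl-β))))
    (trans (pullʳ e2) (trans (pullˡ dstr-inr) (sym (trans (pullʳ dstr-inr) inr-β))))

  dstr-natural₁ : ∀ {A A' B D} {k : Hom A A'} → dstr {A'} {B} {D} ∘ (k ×₁ id) ≡ (k ×₁ id +₁ k ×₁ id) ∘ dstr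
  dstr-natural₁ = dstr-natural first↔second first↔second

  dstr-natural₂ : ∀ {A B B' D D'} {a : Hom B B'} {b : Hom D D'} →
    dstr {A} ∘ (id ×₁ (a +₁ b)) ≡ (id ×₁ a +₁ id ×₁ b) ∘ dstr
  dstr-natural₂ = dstr-natural
    (trans second∘second (trans (cong (id ×₁_) inl-β) (sym second∘second)))
    (trans second∘second (trans (cong (id ×₁_) inr-β) (sym second∘second)))

  dstr-⟨id,snd⟩ : ∀ {W A B} → dstr {W × (A + B)} {A} {B} ∘ ⟨ id , snd ⟩ ≡ (⟨ id ×₁ inl , snd ⟩ +₁ ⟨ id ×₁ inr , snd ⟩) ∘ dstr
  dstr-⟨id,snd⟩ = dstr-natural
    (trans ⟨⟩-∘ (trans (cong₂ ⟨_,_⟩ identityˡ snd-β) (sym id×-⟨⟩)))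
    (trans ⟨⟩-∘ (trans (cong₂ ⟨_,_⟩ identityˡ snd-β) (sym id×-⟨⟩)))

  dstr-snd : ∀ {A B D} → (snd +₁ snd) ∘ dstr {A} {B} {D} ≡ snd
  dstr-snd = dstr-ext
    (trans (pullʳ dstr-inl) (trans inl-β (sym snd-β)))
    (trans (pullʳ dstr-inr) (trans inr-β (sym snd-β)))

  dstr-fst : ∀ {A B D} → [ fst , fst ] ∘ dstr {A} {B} {D} ≡ fst
  dstr-fst = dstr-ext
    (trans (pullʳ dstr-inl) (trans inl-β (sym (trans fst-β identityˡ))))
    (trans (pullʳ dstr-inr) (trans inr-β (sym (trans fst-β identityˡ))))

  -- case u w = inl (w , a) if u w = inl a, and inr (w , b) if u w = inr b.
  case : ∀ {W A B} → Hom W (A + B) → Hom W (W × A + W × B)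
  case u = dstr ∘ ⟨ id , u ⟩

  case-snd : ∀ {W A B} {u : Hom W (A + B)} → (snd +₁ snd) ∘ case u ≡ u
  case-snd = trans (pullˡ dstr-snd) snd-β

  case-fst : ∀ {W A B} {u : Hom W (A + B)} → [ fst , fst ] ∘ case u ≡ id
  case-fst = trans (pullˡ dstr-fst) fst-β

  case-remembers : ∀ {W A B} (u : Hom W (A + B)) →
    (⟨ id , u ⟩ ×₁ id +₁ ⟨ id , u ⟩ ×₁ id) ∘ case u ≡ (⟨ id ×₁ inl , snd ⟩ +₁ ⟨ id ×₁ inr , snd ⟩) ∘ case u
  case-remembers u = begin
    (⟨ id , u ⟩ ×₁ id +₁ ⟨ id , u ⟩ ×₁ id) ∘ (dstr ∘ ⟨ id , u ⟩) ≡⟨ pullˡ (sym dstr-natural₁) ⟩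
    (dstr ∘ (⟨ id , u ⟩ ×₁ id)) ∘ ⟨ id , u ⟩                     ≡⟨ pullʳ (trans ×id-⟨⟩ (cong ⟨_, u ⟩ identityʳ)) ⟩
    dstr ∘ ⟨ ⟨ id , u ⟩ , u ⟩                                     ≡⟨ cong (dstr ∘_) (sym (trans ⟨⟩-∘ (cong₂ ⟨_,_⟩ identityˡ snd-β))) ⟩
    dstr ∘ (⟨ id , snd ⟩ ∘ ⟨ id , u ⟩)                            ≡⟨ pullˡ dstr-⟨id,snd⟩ ⟩
    ((⟨ id ×₁ inl , snd ⟩ +₁ ⟨ id ×₁ inr , snd ⟩) ∘ dstr) ∘ ⟨ id , u ⟩ ≡⟨ assoc ⟩
    (⟨ id ×₁ inl , snd ⟩ +₁ ⟨ id ×₁ inr , snd ⟩) ∘ (dstr ∘ ⟨ id , u ⟩) ∎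

  case-branches : ∀ {W A B Cc E} (u : Hom W (A + B))
    (ρ : Hom ((W × (A + B)) × A) Cc) (σ : Hom ((W × (A + B)) × B) E)
    {r1 r2 : Hom (W × A) Cc} {s1 s2 : Hom (W × B) E} →
    ρ ∘ (⟨ id , u ⟩ ×₁ id) ≡ r1 → ρ ∘ ⟨ id ×₁ inl , snd ⟩ ≡ r2 →
    σ ∘ (⟨ id , u ⟩ ×₁ id) ≡ s1 → σ ∘ ⟨ id ×₁ inr , snd ⟩ ≡ s2 →
    (r1 +₁ s1) ∘ case u ≡ (r2 +₁ s2) ∘ case u
  case-branches u ρ σ {r1} {r2} {s1} {s2} e1 e2 e3 e4 = begin
    (r1 +₁ s1) ∘ case u ≡⟨ cong (_∘ case u) (sym (trans +₁-∘ (cong₂ _+₁_ e1 e3))) ⟩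
    ((ρ +₁ σ) ∘ (⟨ id , u ⟩ ×₁ id +₁ ⟨ id , u ⟩ ×₁ id)) ∘ case u ≡⟨ pullʳ (case-remembers u) ⟩
    (ρ +₁ σ) ∘ ((⟨ id ×₁ inl , snd ⟩ +₁ ⟨ id ×₁ inr , snd ⟩) ∘ case u) ≡⟨ pullˡ (trans +₁-∘ (cong₂ _+₁_ e2 e4)) ⟩
    (r2 +₁ s2) ∘ case u ∎

  case-inl-agree : ∀ {W A B Cc E} (u : Hom W (A + B)) {α β : Hom (W × A) Cc} {γ γ' : Hom (W × B) Cc} (ε : Hom W E) →
    [ α , γ ] ∘ case u ≡ [ β , γ' ] ∘ case u →
    (α +₁ ε ∘ fst) ∘ case u ≡ (β +₁ ε ∘ fst) ∘ case u
  case-inl-agree u {α} {β} {γ} {γ'} ε agree = begin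
    (α +₁ ε ∘ fst) ∘ case u                        ≡⟨ sym (recover α γ) ⟩
    (([ α , γ ] ∘ case u) ∘ fst +₁ ε ∘ fst) ∘ case u ≡⟨ cong (λ z → (z ∘ fst +₁ ε ∘ fst) ∘ case u) agree ⟩
    (([ β , γ' ] ∘ case u) ∘ fst +₁ ε ∘ fst) ∘ case u ≡⟨ recover β γ' ⟩
    (β +₁ ε ∘ fst) ∘ case u                        ∎
    where
    recover : ∀ α γ → (([ α , γ ] ∘ case u) ∘ fst +₁ ε ∘ fst) ∘ case u ≡ (α +₁ ε ∘ fst) ∘ case u
    recover α γ = case-branches u (([ α , γ ] ∘ dstr) ∘ fst) ((ε ∘ fst) ∘ fst)
      (trans fst-∘-×₁ (trans (sym assoc) (cong (_∘ fst) assoc)))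
      (trans (pullʳ fst-β) (trans (pullʳ dstr-inl) inl-β))
      (trans fst-∘-×₁ (pullʳ (trans (pullˡ fst-β) identityˡ)))
      (trans (pullʳ fst-β) (pullʳ (trans fst-β identityˡ)))

  private
    dstl-cocone : ∀ {A B D} P → IsCoproductCocone C (inl {A} {B} ×₁ id {D}) (inr ×₁ id)
    dstl-cocone = proj₂ (coproduct⇔pullbacks (inl ×₁ id) (inr ×₁ id) fst fst fst fst-β fst-β)
    dstl-cocone-inl : ∀ {A B D} P → proj₁ (dstl-cocone {A} {B} {D} P inl inr) ∘ (inl ×₁ id) ≡ inl
    dstl-cocone-inl P = cocone-inl (dstl-cocone P)
    dstl-cocone-inr : ∀ {A B D} P → proj₁ (dstl-cocone {A} {B} {D} P inl inr) ∘ (inr ×₁ id) ≡ inr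
    dstl-cocone-inr P = cocone-inr (dstl-cocone P)
    dstl-cocone-inverse : ∀ {A B D} P → [ inl ×₁ id , inr ×₁ id ] ∘ proj₁ (dstl-cocone {A} {B} {D} P inl inr) ≡ id
    dstl-cocone-inverse P = cocone-inverse (dstl-cocone P)

  dstl-inl : ∀ {A B D} → dstl {A} {B} {D} ∘ (inl ×₁ id) ≡ inl
  dstl-inl = dstl-cocone-inl _

  dstl-inr : ∀ {A B D} → dstl {A} {B} {D} ∘ (inr ×₁ id) ≡ inr
  dstl-inr = dstl-cocone-inr _

  dstl-ext : ∀ {A B D E} {u v : Hom ((A + B) × D) E} →
    u ∘ (inl ×₁ id) ≡ v ∘ (inl ×₁ id) → u ∘ (inr ×₁ id) ≡ v ∘ (inr ×₁ id) → u ≡ v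
  dstl-ext = split-ext {d = dstl} (dstl-cocone-inverse _)

  dstl-natural₂ : ∀ {A B D D'} {k : Hom D D'} → dstl {A} {B} ∘ (id ×₁ k) ≡ (id ×₁ k +₁ id ×₁ k) ∘ dstl
  dstl-natural₂ = dstl-ext
    (trans (pullʳ (sym first↔second)) (trans (pullˡ dstl-inl) (sym (trans (pullʳ dstl-inl) inl-β))))
    (trans (pullʳ (sym first↔second)) (trans (pullˡ dstl-inr) (sym (trans (pullʳ dstl-inr) inr-β))))

  dstl-fst : ∀ {A B D} → (fst +₁ fst) ∘ dstl {A} {B} {D} ≡ fst
  dstl-fst = dstl-ext
    (trans (pullʳ dstl-inl) (trans inl-β (sym fst-β)))
    (trans (pullʳ dstl-inr) (trans inr-β (sym fst-β)))

  curry-∘ : ∀ {Z Z' A} {g : Hom (Z × ℕ) A} {k : Hom Z' Z} → curry g ∘ k ≡ curry (g ∘ (k ×₁ id))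
  curry-∘ {g = g} {k} = curry-unique _ (begin
    eval ∘ ((curry g ∘ k) ×₁ id)          ≡⟨ cong (eval ∘_) (sym (trans ×₁-∘ (cong ((curry g ∘ k) ×₁_) identityˡ))) ⟩
    eval ∘ ((curry g ×₁ id) ∘ (k ×₁ id))  ≡⟨ pullˡ curry-β ⟩
    g ∘ (k ×₁ id)                         ∎)

  curry-injective : ∀ {Z A} {g g' : Hom (Z × ℕ) A} → curry g ≡ curry g' → g ≡ g'
  curry-injective e = trans (sym curry-β) (trans (cong (λ z → eval ∘ (z ×₁ id)) e) curry-β)

  shift : ∀ {A} → Hom (A ^N) (A ^N)
  shift = curry (eval ∘ (id ×₁ succ))

  shift-curry : ∀ {Z A} {g : Hom (Z × ℕ) A} → shift ∘ curry g ≡ curry (g ∘ (id ×₁ succ))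
  shift-curry {g = g} = curry-unique _ (begin
    eval ∘ ((shift ∘ curry g) ×₁ id)            ≡⟨ cong (eval ∘_) (sym (trans ×₁-∘ (cong ((shift ∘ curry g) ×₁_) identityˡ))) ⟩
    eval ∘ ((shift ×₁ id) ∘ (curry g ×₁ id))    ≡⟨ pullˡ curry-β ⟩
    (eval ∘ (id ×₁ succ)) ∘ (curry g ×₁ id)     ≡⟨ pullʳ (sym first↔second) ⟩
    eval ∘ ((curry g ×₁ id) ∘ (id ×₁ succ))     ≡⟨ pullˡ curry-β ⟩
    g ∘ (id ×₁ succ)                            ∎)

module Restriction {o ℓ : Level} {C : Category o ℓ} (S : Standing C) (H : Theory.Hypotheses S) where
  open Theory S
  open WithHyp H
  open Hypotheses H
  open Basics S

  alg : ∀ Y → IterAlg (K Y)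
  alg Y = FreeIterAlg.alg (free Y)

  fixpoint : ∀ {Y Z} (f : Hom Z (K Y + Z)) → iter Y f ≡ [ id , iter Y f ] ∘ f
  fixpoint {Y} = IterAlg.fixpoint (alg Y)

  uniformity : ∀ {Y Z W} {f : Hom Z (K Y + Z)} {g : Hom W (K Y + W)} (k : Hom Z W) →
    (id +₁ k) ∘ f ≡ g ∘ k → iter Y f ≡ iter Y g ∘ k
  uniformity {Y} {f = f} {g} = IterAlg.uniformity (alg Y) f g

  iter-inr : ∀ {Y Z} → iter Y (inr {K Y} {Z}) ≡ diverge Y ∘ !
  iter-inr = uniformity ! inr-β

  kl-η : ∀ {X Y} {f : Hom X (K Y)} → kl f ∘ η ≡ f
  kl-η {X} {Y} {f} = FreeIterAlg.lift-η (free X) (alg Y) f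

  kl-iter : ∀ {X Y Z} {f : Hom X (K Y)} (g : Hom Z (K X + Z)) → kl f ∘ iter X g ≡ iter Y ((kl f +₁ id) ∘ g)
  kl-iter {X} {Y} {f = f} = FreeIterAlg.lift-morph (free X) (alg Y) f

  τ-η : ∀ {A B} → τ A B ∘ (id ×₁ η) ≡ η
  τ-η {A} {B} = trans (pullʳ (IsStable.slift-η (stable A B) _ ⟨ fst , η ⟩ fst-β)) snd-β

  τ-iter : ∀ {A B Z} (p : Hom Z A) (F : Hom Z ((A × K B) + Z)) → [ fst , p ] ∘ F ≡ p →
    τ A B ∘ ⟨ p , iter B ((snd +₁ id) ∘ F) ⟩ ≡ iter (A × B) ((τ A B +₁ id) ∘ F)
  τ-iter {A} {B} p F over = begin
    (snd ∘ σ) ∘ ⟨ p , iter B ((snd +₁ id) ∘ F) ⟩          ≡⟨ pullʳ (proj₂ σ-morph p F over over') ⟩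
    snd ∘ ⟨ p , iter (A × B) ((snd +₁ id) ∘ ((σ +₁ id) ∘ F)) ⟩ ≡⟨ snd-β ⟩
    iter (A × B) ((snd +₁ id) ∘ ((σ +₁ id) ∘ F))             ≡⟨ cong (iter (A × B)) (pullˡ (trans +₁-∘ (cong (snd ∘ σ +₁_) identityˡ))) ⟩
    iter (A × B) ((τ A B +₁ id) ∘ F)                          ∎
    where
    σ : Hom (A × K B) (A × K (A × B))
    σ = IsStable.slift (stable A B) (canonSlice A (alg (A × B))) ⟨ fst , η ⟩ fst-β
    σ-morph : IsSliceMorph (canonSlice A (alg B)) (canonSlice A (alg (A × B))) σ
    σ-morph = IsStable.slift-morph (stable A B) (canonSlice A (alg (A × B))) ⟨ fst , η ⟩ fst-β
    over' : [ fst , p ] ∘ ((σ +₁ id) ∘ F) ≡ p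
    over' = trans (pullˡ (trans []-+₁ (cong₂ [_,_] (proj₁ σ-morph) identityʳ))) over

  infixl 8 _↓_
  _↓_ : ∀ {W Y} → Hom W (K Y) → Hom W (K Y) → Hom W (K Y)
  _↓_ {Y = Y} f g = restr Y Y f g

  restrict : ∀ {Y} → Hom (K Y × K Y) (K Y)
  restrict {Y} = kl (fst {K Y} {Y}) ∘ τ (K Y) Y

  restrict-⟨⟩ : ∀ {W Y} {f g : Hom W (K Y)} → restrict ∘ ⟨ f , g ⟩ ≡ f ↓ g
  restrict-⟨⟩ = assoc

  ↓-∘ : ∀ {V W Y} {f g : Hom W (K Y)} {k : Hom V W} → (f ↓ g) ∘ k ≡ (f ∘ k) ↓ (g ∘ k)
  ↓-∘ = pullʳ (pullʳ ⟨⟩-∘)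

  id↓id-∘ : ∀ {W Y} {k : Hom W (K Y)} → (id ↓ id) ∘ k ≡ k ↓ k
  id↓id-∘ = trans ↓-∘ (cong₂ _↓_ identityˡ identityˡ)

  ↓-[] : ∀ {A B Y} {f₁ g₁ : Hom A (K Y)} {f₂ g₂ : Hom B (K Y)} →
    [ f₁ ↓ g₁ , f₂ ↓ g₂ ] ≡ [ f₁ , f₂ ] ↓ [ g₁ , g₂ ]
  ↓-[] = sym ([]-unique _ (trans ↓-∘ (cong₂ _↓_ inl-β inl-β)) (trans ↓-∘ (cong₂ _↓_ inr-β inr-β)))

  ↓-iter : ∀ {Y Z} (p : Hom Z (K Y)) (F : Hom Z ((K Y × K Y) + Z)) → [ fst , p ] ∘ F ≡ p →
    p ↓ iter Y ((snd +₁ id) ∘ F) ≡ iter Y ((restrict +₁ id) ∘ F)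
  ↓-iter {Y} p F over = begin
    kl fst ∘ (τ (K Y) Y ∘ ⟨ p , iter Y ((snd +₁ id) ∘ F) ⟩) ≡⟨ cong (kl fst ∘_) (τ-iter p F over) ⟩
    kl fst ∘ iter (K Y × Y) ((τ (K Y) Y +₁ id) ∘ F)        ≡⟨ kl-iter _ ⟩
    iter Y ((kl fst +₁ id) ∘ ((τ (K Y) Y +₁ id) ∘ F))        ≡⟨ cong (iter Y) (pullˡ (trans +₁-∘ (cong (restrict +₁_) identityˡ))) ⟩
    iter Y ((restrict +₁ id) ∘ F)                             ∎

  ↓-diverge : ∀ {W Y} (q : Hom W (K Y)) → q ↓ (diverge Y ∘ !) ≡ diverge Y ∘ !
  ↓-diverge {Y = Y} q = begin
    q ↓ (diverge Y ∘ !)                ≡⟨ cong (q ↓_) (trans (sym iter-inr) (cong (iter Y) (sym (trans inr-β identityʳ)))) ⟩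
    q ↓ iter Y ((snd +₁ id) ∘ inr)     ≡⟨ ↓-iter q inr inr-β ⟩
    iter Y ((restrict +₁ id) ∘ inr)    ≡⟨ trans (cong (iter Y) (trans inr-β identityʳ)) iter-inr ⟩
    diverge Y ∘ !                      ∎

  -- On the left branch of case h we have h z = inl a, hence iter Y h z = a.
  case-iter-inl : ∀ {Y Z Cc E} (h : Hom Z (K Y + Z)) (ρ : Hom (K Y × K Y) Cc) (ε : Hom (Z × Z) E) →
    (ρ ∘ (iter Y h ×₁ id) +₁ ε) ∘ case h ≡ (ρ ∘ ⟨ snd , snd ⟩ +₁ ε) ∘ case h
  case-iter-inl {Y} h ρ ε = case-branches h (ρ ∘ ⟨ ([ id , iter Y h ] ∘ snd) ∘ fst , snd ⟩) (ε ∘ (fst ×₁ id))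
    (pullʳ (trans ⟨⟩-∘ (cong₂ ⟨_,_⟩ (trans fst-∘-×₁ (pullˡ unfold)) snd-β)))
    (pullʳ (trans ⟨⟩-∘ (cong₂ ⟨_,_⟩ (trans (pullʳ fst-β) (trans (pullʳ snd-β) (trans (pullˡ inl-β) identityˡ))) snd-β)))
    (trans (pullʳ (trans ×₁-∘ (trans (cong₂ _×₁_ fst-β identityˡ) ×₁-id))) identityʳ)
    (trans (pullʳ (trans ×₁-⟨⟩ (trans (cong₂ ⟨_,_⟩ (trans fst-β identityˡ) identityˡ) (sym (⟨⟩-unique id identityʳ identityʳ))))) identityʳ)
    where
    unfold : ([ id , iter Y h ] ∘ snd) ∘ ⟨ id , h ⟩ ≡ iter Y h
    unfold = trans (pullʳ snd-β) (sym (fixpoint h))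

  ↓-idem : ∀ {Y} → id ↓ id ≡ id {K Y}
  ↓-idem {Y} = trans (FreeIterAlg.lift-unique (free Y) (alg Y) η (id ↓ id) preserves-iter fixes-η)
                     (sym (FreeIterAlg.lift-unique (free Y) (alg Y) η id id-preserves-iter identityˡ))
    where
    id-preserves-iter : ∀ {Z} (h : Hom Z (K Y + Z)) → id ∘ iter Y h ≡ iter Y ((id +₁ id) ∘ h)
    id-preserves-iter h = trans identityˡ (cong (iter Y) (sym (trans (cong (_∘ h) +₁-id) identityˡ)))

    fixes-η : (id ↓ id) ∘ η ≡ η
    fixes-η = begin
      (id ↓ id) ∘ η                                   ≡⟨ id↓id-∘ ⟩
      kl fst ∘ (τ (K Y) Y ∘ ⟨ η , η ⟩)                 ≡⟨ cong (λ z → kl fst ∘ (τ (K Y) Y ∘ z)) (sym (trans id×-⟨⟩ (cong ⟨ η ,_⟩ identityʳ))) ⟩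
      kl fst ∘ (τ (K Y) Y ∘ ((id ×₁ η) ∘ ⟨ η , id ⟩)) ≡⟨ cong (kl fst ∘_) (pullˡ τ-η) ⟩
      kl fst ∘ (η ∘ ⟨ η , id ⟩)                        ≡⟨ pullˡ kl-η ⟩
      fst ∘ ⟨ η , id ⟩                                 ≡⟨ fst-β ⟩
      η                                                ∎

    preserves-iter : ∀ {Z} (h : Hom Z (K Y + Z)) → (id ↓ id) ∘ iter Y h ≡ iter Y (((id ↓ id) +₁ id) ∘ h)
    preserves-iter {Z} h = begin
      (id ↓ id) ∘ h†                   ≡⟨ id↓id-∘ ⟩
      h† ↓ h†                          ≡⟨ cong (λ z → h† ↓ iter Y z) (sym F-snd) ⟩
      h† ↓ iter Y ((snd +₁ id) ∘ F)    ≡⟨ ↓-iter h† F F-over ⟩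
      iter Y ((restrict +₁ id) ∘ F)    ≡⟨ cong (iter Y) F-restrict ⟩
      iter Y (((id ↓ id) +₁ id) ∘ h)   ∎
      where
      h† : Hom Z (K Y)
      h† = iter Y h
      F : Hom Z ((K Y × K Y) + Z)
      F = (h† ×₁ id +₁ snd) ∘ case h

      F-snd : (snd +₁ id) ∘ F ≡ h
      F-snd = trans (pullˡ (trans +₁-∘ (cong₂ _+₁_ (trans snd-β identityˡ) identityˡ))) case-snd

      F-over : [ fst , h† ] ∘ F ≡ h†
      F-over = begin
        [ fst , h† ] ∘ F                                       ≡⟨ pullˡ (trans []-+₁ (sym codiag-+₁)) ⟩
        ([ id , id ] ∘ (fst ∘ (h† ×₁ id) +₁ h† ∘ snd)) ∘ case h ≡⟨ pullʳ (case-iter-inl h fst (h† ∘ snd)) ⟩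
        [ id , id ] ∘ ((fst ∘ ⟨ snd , snd ⟩ +₁ h† ∘ snd) ∘ case h) ≡⟨ pullˡ (trans codiag-+₁ (cong₂ [_,_] (trans fst-β (sym identityˡ)) refl)) ⟩
        [ id ∘ snd , h† ∘ snd ] ∘ case h                        ≡⟨ cong (_∘ case h) (sym []-+₁) ⟩
        ([ id , h† ] ∘ (snd +₁ snd)) ∘ case h                   ≡⟨ pullʳ case-snd ⟩
        [ id , h† ] ∘ h                                         ≡⟨ sym (fixpoint h) ⟩
        h†                                                      ∎

      F-restrict : (restrict +₁ id) ∘ F ≡ ((id ↓ id) +₁ id) ∘ h
      F-restrict = begin
        (restrict +₁ id) ∘ F                                   ≡⟨ pullˡ (trans +₁-∘ (cong (restrict ∘ (h† ×₁ id) +₁_) identityˡ)) ⟩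
        (restrict ∘ (h† ×₁ id) +₁ snd) ∘ case h                ≡⟨ case-iter-inl h restrict snd ⟩
        (restrict ∘ ⟨ snd , snd ⟩ +₁ snd) ∘ case h             ≡⟨ cong (_∘ case h) (cong₂ _+₁_ diagonal (sym identityˡ)) ⟩
        ((id ↓ id) ∘ snd +₁ id ∘ snd) ∘ case h                 ≡⟨ sym (pullˡ +₁-∘) ⟩
        ((id ↓ id) +₁ id) ∘ ((snd +₁ snd) ∘ case h)            ≡⟨ cong (((id ↓ id) +₁ id) ∘_) case-snd ⟩
        ((id ↓ id) +₁ id) ∘ h                                   ∎
        where
        diagonal : restrict ∘ ⟨ snd , snd ⟩ ≡ (id ↓ id) ∘ snd
        diagonal = trans restrict-⟨⟩ (sym id↓id-∘)

module BoundedIteration {o ℓ : Level} {C : Category o ℓ} (S : Standing C) (H : Theory.Hypotheses S) where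
  open Theory S
  open WithHyp H
  open Basics S
  open Restriction S H

  module _ {X Y : Obj} (f : Hom X (K Y + X)) where

    f† : Hom X (K Y)
    f† = iter Y f

    state : Hom (X × ℕ) (K Y + X)
    state = rec inr [ inl , f ]

    state-zero : state ∘ ⟨ id , zero ∘ ! ⟩ ≡ inr
    state-zero = rec-zero

    state-succ : state ∘ (id ×₁ succ) ≡ [ inl , f ] ∘ state
    state-succ = rec-succ

    iter-state : f† ∘ fst ≡ [ id , f† ] ∘ state
    iter-state = trans
      (rec-unique _ (trans (pullʳ fst-β) identityʳ) (trans (pullʳ (trans fst-β identityˡ)) (sym identityˡ)))
      (sym (rec-unique _ (trans (pullʳ state-zero) inr-β) (trans (pullʳ state-succ) (trans (pullˡ fixed) (sym identityˡ)))))
      where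
      fixed : [ id , f† ] ∘ [ inl , f ] ≡ [ id , f† ]
      fixed = trans []-∘ (cong₂ [_,_] inl-β (sym (fixpoint f)))

    state-succ-head : state ∘ (id ×₁ succ) ≡ [ inl ∘ fst , state ] ∘ (dstl ∘ (f ×₁ id))
    state-succ-head = trans
      (rec-unique _ (trans (cong (_∘ ⟨ id , zero ∘ ! ⟩) state-succ) (trans (pullʳ state-zero) inr-β)) (trans (cong (_∘ (id ×₁ succ)) state-succ) assoc))
      (sym (rec-unique _ head-zero head-succ))
      where
      head : Hom (X × ℕ) (K Y + X)
      head = [ inl ∘ fst , state ] ∘ (dstl ∘ (f ×₁ id))

      head-zero : head ∘ ⟨ id , zero ∘ ! ⟩ ≡ f
      head-zero = begin
        head ∘ ⟨ id , zero ∘ ! ⟩                                         ≡⟨ pullʳ (pullʳ (trans ×₁-⟨⟩ (trans (cong₂ ⟨_,_⟩ identityʳ (trans identityˡ (sym zero!-∘))) (sym id×-⟨⟩)))) ⟩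
        [ inl ∘ fst , state ] ∘ (dstl ∘ ((id ×₁ (zero ∘ !)) ∘ ⟨ f , id ⟩)) ≡⟨ cong ([ inl ∘ fst , state ] ∘_) (pullˡ dstl-natural₂) ⟩
        [ inl ∘ fst , state ] ∘ (((id ×₁ (zero ∘ !) +₁ id ×₁ (zero ∘ !)) ∘ dstl) ∘ ⟨ f , id ⟩) ≡⟨ trans (cong ([ inl ∘ fst , state ] ∘_) assoc) (pullˡ (trans []-+₁ (cong₂ [_,_] inl-side inr-side))) ⟩
        (fst +₁ fst) ∘ (dstl ∘ ⟨ f , id ⟩)                                ≡⟨ pullˡ dstl-fst ⟩
        fst ∘ ⟨ f , id ⟩                                                 ≡⟨ fst-β ⟩
        f                                                                ∎
        where
        inl-side : (inl ∘ fst) ∘ (id ×₁ (zero ∘ !)) ≡ inl ∘ fst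
        inl-side = pullʳ (trans fst-β identityˡ)
        inr-side : state ∘ (id ×₁ (zero ∘ !)) ≡ inr ∘ fst
        inr-side = trans (cong (state ∘_) id×zero!) (pullˡ state-zero)

      head-succ : head ∘ (id ×₁ succ) ≡ [ inl , f ] ∘ head
      head-succ = begin
        head ∘ (id ×₁ succ)                                               ≡⟨ pullʳ (pullʳ first↔second) ⟩
        [ inl ∘ fst , state ] ∘ (dstl ∘ ((id ×₁ succ) ∘ (f ×₁ id)))        ≡⟨ cong ([ inl ∘ fst , state ] ∘_) (pullˡ dstl-natural₂) ⟩
        [ inl ∘ fst , state ] ∘ (((id ×₁ succ +₁ id ×₁ succ) ∘ dstl) ∘ (f ×₁ id)) ≡⟨ trans (cong ([ inl ∘ fst , state ] ∘_) assoc) (pullˡ []-+₁) ⟩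
        [ (inl ∘ fst) ∘ (id ×₁ succ) , state ∘ (id ×₁ succ) ] ∘ (dstl ∘ (f ×₁ id)) ≡⟨ cong (_∘ (dstl ∘ (f ×₁ id))) (cong₂ [_,_] (pullʳ (trans fst-β identityˡ)) state-succ) ⟩
        [ inl ∘ fst , [ inl , f ] ∘ state ] ∘ (dstl ∘ (f ×₁ id))          ≡⟨ cong (_∘ (dstl ∘ (f ×₁ id))) (sym (trans []-∘ (cong₂ [_,_] (pullˡ inl-β) refl))) ⟩
        ([ inl , f ] ∘ [ inl ∘ fst , state ]) ∘ (dstl ∘ (f ×₁ id))          ≡⟨ assoc ⟩
        [ inl , f ] ∘ head                                                 ∎

    bounded : Hom (X × ℕ) (K Y)
    bounded = [ id , diverge Y ∘ ! ] ∘ state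

    bounded-isBoundedIter : IsBoundedIter Y f bounded
    bounded-isBoundedIter = trans (pullʳ state-zero) inr-β ,,
      trans (pullʳ state-succ-head) (pullˡ (trans []-∘ (cong₂ [_,_] (trans (pullˡ inl-β) identityˡ) refl)))

    budget-state : Hom ((X × ℕ) × ℕ) ((K Y + X) × ℕ)
    budget-state = ⟨ state ∘ (fst ×₁ id) , snd ∘ fst ⟩

    -- after-steps r ((x , m) , n) runs f for n steps from x and, unless it has terminated, continues
    -- from the state y reached with r (y , m). Recursion on m through ℕ-exponentials determines it,
    -- which gives uniqueness of the bounded iterate although its recurrence changes the parameter.
    after-steps : Hom (X × ℕ) (K Y) → Hom ((X × ℕ) × ℕ) (K Y)
    after-steps r = [ fst , r ] ∘ (dstl ∘ budget-state)

    after-steps-now : ∀ r → after-steps r ∘ ⟨ id , zero ∘ ! ⟩ ≡ r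
    after-steps-now r = trans (pullʳ (pullʳ starts)) (trans (cong ([ fst , r ] ∘_) dstl-inr) inr-β)
      where
      starts : budget-state ∘ ⟨ id , zero ∘ ! ⟩ ≡ inr ×₁ id
      starts = trans ⟨⟩-∘ (cong₂ ⟨_,_⟩
        (trans (pullʳ (trans ×₁-⟨⟩ (trans (cong₂ ⟨_,_⟩ (trans identityʳ (sym identityˡ)) (trans identityˡ (sym zero!-∘))) (sym ⟨⟩-∘)))) (pullˡ state-zero))
        (trans (pullʳ fst-β) (trans identityʳ (sym identityˡ))))

    module _ {r : Hom (X × ℕ) (K Y)} (isb : IsBoundedIter Y f r) where
      after-steps-no-budget : after-steps r ∘ (⟨ id , zero ∘ ! ⟩ ×₁ id) ≡ bounded
      after-steps-no-budget = begin
        after-steps r ∘ (⟨ id , zero ∘ ! ⟩ ×₁ id)                             ≡⟨ pullʳ (pullʳ no-budget) ⟩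
        [ fst , r ] ∘ (dstl ∘ ((id ×₁ (zero ∘ !)) ∘ ⟨ state , fst ⟩))          ≡⟨ cong ([ fst , r ] ∘_) (pullˡ dstl-natural₂) ⟩
        [ fst , r ] ∘ (((id ×₁ (zero ∘ !) +₁ id ×₁ (zero ∘ !)) ∘ dstl) ∘ ⟨ state , fst ⟩) ≡⟨ trans (cong ([ fst , r ] ∘_) assoc) (pullˡ []-+₁) ⟩
        [ fst ∘ (id ×₁ (zero ∘ !)) , r ∘ (id ×₁ (zero ∘ !)) ] ∘ (dstl ∘ ⟨ state , fst ⟩) ≡⟨ cong (_∘ (dstl ∘ ⟨ state , fst ⟩)) (trans (cong₂ [_,_] fst-β diverges) (sym []-+₁)) ⟩
        ([ id , diverge Y ∘ ! ] ∘ (fst +₁ fst)) ∘ (dstl ∘ ⟨ state , fst ⟩)      ≡⟨ pullʳ (trans (pullˡ dstl-fst) fst-β) ⟩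
        bounded                                                                ∎
        where
        diverges : r ∘ (id ×₁ (zero ∘ !)) ≡ (diverge Y ∘ !) ∘ fst
        diverges = trans (cong (r ∘_) id×zero!) (pullˡ (proj₁ isb))
        no-budget : budget-state ∘ (⟨ id , zero ∘ ! ⟩ ×₁ id) ≡ (id ×₁ (zero ∘ !)) ∘ ⟨ state , fst ⟩
        no-budget = trans ⟨⟩-∘ (trans (cong₂ ⟨_,_⟩
               (trans (pullʳ (trans ×₁-∘ (trans (cong₂ _×₁_ fst-β identityˡ) ×₁-id))) identityʳ)
               (trans (pullʳ fst-β) (pullˡ snd-β)))
             (sym id×-⟨⟩))

      after-steps-succ : after-steps r ∘ ((id ×₁ succ) ×₁ id) ≡ after-steps r ∘ (id ×₁ succ)
      after-steps-succ = begin
        after-steps r ∘ ((id ×₁ succ) ×₁ id)                          ≡⟨ pullʳ (pullʳ budget-succ) ⟩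
        [ fst , r ] ∘ (dstl ∘ ((id ×₁ succ) ∘ budget-state))          ≡⟨ cong ([ fst , r ] ∘_) (pullˡ dstl-natural₂) ⟩
        [ fst , r ] ∘ (((id ×₁ succ +₁ id ×₁ succ) ∘ dstl) ∘ budget-state) ≡⟨ trans (cong ([ fst , r ] ∘_) assoc) (pullˡ []-+₁) ⟩
        [ fst ∘ (id ×₁ succ) , r ∘ (id ×₁ succ) ] ∘ (dstl ∘ budget-state) ≡⟨ cong (_∘ (dstl ∘ budget-state)) (cong₂ [_,_] (trans fst-β identityˡ) (proj₂ isb)) ⟩
        [ fst , [ fst , r ] ∘ (dstl ∘ (f ×₁ id)) ] ∘ (dstl ∘ budget-state) ≡⟨ pullˡ one-more-step ⟩
        (([ fst , r ] ∘ dstl) ∘ ([ inl , f ] ×₁ id)) ∘ budget-state    ≡⟨ trans (pullʳ (sym state-succ-budget)) assoc ⟩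
        [ fst , r ] ∘ (dstl ∘ (budget-state ∘ (id ×₁ succ)))          ≡⟨ sym (pullʳ assoc) ⟩
        after-steps r ∘ (id ×₁ succ)                                  ∎
        where
        one-more-step : [ fst , [ fst , r ] ∘ (dstl ∘ (f ×₁ id)) ] ∘ dstl ≡ ([ fst , r ] ∘ dstl) ∘ ([ inl , f ] ×₁ id)
        one-more-step = dstl-ext
          (trans (trans (pullʳ dstl-inl) inl-β)
                 (sym (trans (pullʳ (trans ×₁-∘ (cong₂ _×₁_ inl-β identityˡ))) (trans (pullʳ dstl-inl) inl-β))))
          (trans (trans (pullʳ dstl-inr) inr-β)
                 (sym (trans (pullʳ (trans ×₁-∘ (cong₂ _×₁_ inr-β identityˡ))) assoc)))
        budget-succ : budget-state ∘ ((id ×₁ succ) ×₁ id) ≡ (id ×₁ succ) ∘ budget-state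
        budget-succ = trans ⟨⟩-∘ (trans (cong₂ ⟨_,_⟩
          (pullʳ (trans ×₁-∘ (cong₂ _×₁_ (trans fst-β identityˡ) identityˡ)))
          (trans (pullʳ fst-β) (trans (pullˡ snd-β) assoc)))
          (sym id×-⟨⟩))
        state-succ-budget : budget-state ∘ (id ×₁ succ) ≡ ([ inl , f ] ×₁ id) ∘ budget-state
        state-succ-budget = trans ⟨⟩-∘ (trans (cong₂ ⟨_,_⟩
          (trans (pullʳ first↔second) (trans (pullˡ state-succ) assoc))
          (pullʳ (trans fst-β identityˡ)))
          (sym ×id-⟨⟩))

      curry-after-steps : curry (after-steps r) ≡ rec (curry bounded) shift
      curry-after-steps = rec-unique _
        (trans curry-∘ (cong curry after-steps-no-budget))
        (trans curry-∘ (trans (cong curry after-steps-succ) (sym shift-curry)))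

    isBoundedIter-unique : ∀ {r} → IsBoundedIter Y f r → r ≡ bounded
    isBoundedIter-unique {r} isb = begin
      r                                        ≡⟨ sym (after-steps-now r) ⟩
      after-steps r ∘ ⟨ id , zero ∘ ! ⟩        ≡⟨ cong (_∘ ⟨ id , zero ∘ ! ⟩) (curry-injective same-curry) ⟩
      after-steps bounded ∘ ⟨ id , zero ∘ ! ⟩  ≡⟨ after-steps-now bounded ⟩
      bounded                                  ∎
      where
      same-curry : curry (after-steps r) ≡ curry (after-steps bounded)
      same-curry = trans (curry-after-steps isb) (sym (curry-after-steps bounded-isBoundedIter))

    isBoundedIter-below-iter : ∀ {b} → IsBoundedIter Y f b → Below Y b (f† ∘ fst)
    isBoundedIter-below-iter {b} isb = begin
      b                                                  ≡⟨ isBoundedIter-unique isb ⟩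
      [ id , diverge Y ∘ ! ] ∘ state                     ≡⟨ cong (_∘ state) (sym (cong₂ [_,_] ↓-idem (↓-diverge f†))) ⟩
      [ id ↓ id , f† ↓ (diverge Y ∘ !) ] ∘ state         ≡⟨ cong (_∘ state) ↓-[] ⟩
      ([ id , f† ] ↓ [ id , diverge Y ∘ ! ]) ∘ state     ≡⟨ ↓-∘ ⟩
      ([ id , f† ] ∘ state) ↓ bounded                    ≡⟨ cong₂ _↓_ (sym iter-state) (sym (isBoundedIter-unique isb)) ⟩
      (f† ∘ fst) ↓ b                                     ∎

    resume : Hom (K Y + X) (K Y + (K Y + X))
    resume = [ inl , (id +₁ inr) ∘ f ]

    iter-resume : iter Y resume ≡ [ id , f† ]
    iter-resume = []-ext
      (trans (cong (_∘ inl) (fixpoint resume)) (trans (pullʳ inl-β) (trans inl-β (sym inl-β))))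
      (trans (sym (uniformity inr (sym inr-β))) (sym inr-β))

    resume-tagged : Hom (X × (K Y + X)) (X × K Y + X × (K Y + X))
    resume-tagged = dstr ∘ (id ×₁ resume)

    iter-resume-tagged : iter Y ((snd +₁ id) ∘ resume-tagged) ≡ [ id , f† ] ∘ snd
    iter-resume-tagged = trans (uniformity snd forget-tag) (cong (_∘ snd) iter-resume)
      where
      forget-tag : (id +₁ snd) ∘ ((snd +₁ id) ∘ resume-tagged) ≡ resume ∘ snd
      forget-tag = trans (pullˡ (trans +₁-∘ (cong₂ _+₁_ identityˡ identityʳ))) (trans (pullˡ dstr-snd) snd-β)

    progress : Hom (X × ℕ) (X × (K Y + X))
    progress = ⟨ fst , state ⟩

    next-state : Hom (X × ℕ) (K Y + X)
    next-state = state ∘ (id ×₁ succ)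

    -- clocked (x , n) = inl (x , a) if state (x , n + 1) = inl a, and inr (x , n + 1) otherwise.
    clocked : Hom (X × ℕ) (X × K Y + X × ℕ)
    clocked = (fst ×₁ id +₁ (id ×₁ succ) ∘ fst) ∘ case next-state

    resume-tagged-progress : resume-tagged ∘ progress ≡ (fst ×₁ id +₁ (fst ×₁ id) ∘ (id ×₁ inr)) ∘ case next-state
    resume-tagged-progress = begin
      (dstr ∘ (id ×₁ resume)) ∘ ⟨ fst , state ⟩                         ≡⟨ pullʳ id×-⟨⟩ ⟩
      dstr ∘ ⟨ fst , resume ∘ state ⟩                                   ≡⟨ cong (λ z → dstr ∘ ⟨ fst , z ⟩) resume-state ⟩
      dstr ∘ ⟨ fst , (id +₁ inr) ∘ next-state ⟩                         ≡⟨ cong (dstr ∘_) (sym (trans (cong ((id ×₁ (id +₁ inr)) ∘_) (trans ×id-⟨⟩ (cong ⟨_, next-state ⟩ identityʳ))) id×-⟨⟩)) ⟩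
      dstr ∘ ((id ×₁ (id +₁ inr)) ∘ ((fst ×₁ id) ∘ ⟨ id , next-state ⟩)) ≡⟨ pullˡ dstr-natural₂ ⟩
      ((id ×₁ id +₁ id ×₁ inr) ∘ dstr) ∘ ((fst ×₁ id) ∘ ⟨ id , next-state ⟩) ≡⟨ pullʳ (pullˡ dstr-natural₁) ⟩
      (id ×₁ id +₁ id ×₁ inr) ∘ (((fst ×₁ id +₁ fst ×₁ id) ∘ dstr) ∘ ⟨ id , next-state ⟩) ≡⟨ trans (cong ((id ×₁ id +₁ id ×₁ inr) ∘_) assoc) (sym assoc) ⟩
      ((id ×₁ id +₁ id ×₁ inr) ∘ (fst ×₁ id +₁ fst ×₁ id)) ∘ case next-state ≡⟨ cong (_∘ case next-state) (trans +₁-∘ (cong₂ _+₁_ (trans (cong (_∘ (fst ×₁ id)) ×₁-id) identityˡ) (sym first↔second))) ⟩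
      (fst ×₁ id +₁ (fst ×₁ id) ∘ (id ×₁ inr)) ∘ case next-state        ∎
      where
      resume-state : resume ∘ state ≡ (id +₁ inr) ∘ next-state
      resume-state = begin
        resume ∘ state                      ≡⟨ cong (_∘ state) (sym (trans []-∘ (cong₂ [_,_] (trans inl-β identityʳ) refl))) ⟩
        ((id +₁ inr) ∘ [ inl , f ]) ∘ state ≡⟨ pullʳ (sym state-succ) ⟩
        (id +₁ inr) ∘ next-state            ∎

    progress-simulates : (id +₁ progress) ∘ clocked ≡ resume-tagged ∘ progress
    progress-simulates = begin
      (id +₁ progress) ∘ clocked                                         ≡⟨ pullˡ +₁-∘ ⟩
      (id ∘ (fst ×₁ id) +₁ progress ∘ ((id ×₁ succ) ∘ fst)) ∘ case next-state
        ≡⟨ case-branches next-state ((fst ×₁ id) ∘ (fst ×₁ id)) ((fst ×₁ id) ∘ fst) inl-forget inl-tag inr-forget inr-tag ⟩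
      (fst ×₁ id +₁ (fst ×₁ id) ∘ (id ×₁ inr)) ∘ case next-state          ≡⟨ sym resume-tagged-progress ⟩
      resume-tagged ∘ progress                                           ∎
      where
      inl-forget : ((fst ×₁ id) ∘ (fst ×₁ id)) ∘ (⟨ id , next-state ⟩ ×₁ id) ≡ id ∘ (fst ×₁ id)
      inl-forget = trans (pullʳ (trans ×₁-∘ (trans (cong₂ _×₁_ fst-β identityˡ) ×₁-id))) (trans identityʳ (sym identityˡ))
      inl-tag : ((fst ×₁ id) ∘ (fst ×₁ id)) ∘ ⟨ id ×₁ inl , snd ⟩ ≡ fst ×₁ id
      inl-tag = trans (pullʳ (trans ×id-⟨⟩ (trans (cong ⟨_, snd ⟩ fst-β) (sym (⟨⟩-unique id (trans identityʳ (sym identityˡ)) identityʳ))))) identityʳ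
      inr-forget : ((fst ×₁ id) ∘ fst) ∘ (⟨ id , next-state ⟩ ×₁ id) ≡ progress ∘ ((id ×₁ succ) ∘ fst)
      inr-forget = trans fst-∘-×₁ (trans (pullˡ (trans ×id-⟨⟩ (cong ⟨_, next-state ⟩ identityʳ)))
        (sym (pullˡ (trans ⟨⟩-∘ (cong ⟨_, next-state ⟩ (trans fst-β identityˡ))))))
      inr-tag : ((fst ×₁ id) ∘ fst) ∘ ⟨ id ×₁ inr , snd ⟩ ≡ (fst ×₁ id) ∘ (id ×₁ inr)
      inr-tag = pullʳ fst-β

    iter-resume-tagged-start : ∀ (φ : Hom (X × K Y) (K Y)) →
      iter Y ((φ +₁ id) ∘ resume-tagged) ∘ ⟨ id , inr ⟩ ≡ iter Y ((φ +₁ id) ∘ clocked) ∘ ⟨ id , zero ∘ ! ⟩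
    iter-resume-tagged-start φ = begin
      iter Y ((φ +₁ id) ∘ resume-tagged) ∘ ⟨ id , inr ⟩                 ≡⟨ cong (iter Y ((φ +₁ id) ∘ resume-tagged) ∘_) (sym progress-zero) ⟩
      iter Y ((φ +₁ id) ∘ resume-tagged) ∘ (progress ∘ ⟨ id , zero ∘ ! ⟩) ≡⟨ pullˡ (sym (uniformity progress simulation)) ⟩
      iter Y ((φ +₁ id) ∘ clocked) ∘ ⟨ id , zero ∘ ! ⟩                  ∎
      where
      progress-zero : progress ∘ ⟨ id , zero ∘ ! ⟩ ≡ ⟨ id , inr ⟩
      progress-zero = trans ⟨⟩-∘ (cong₂ ⟨_,_⟩ fst-β state-zero)
      simulation : (id +₁ progress) ∘ ((φ +₁ id) ∘ clocked) ≡ ((φ +₁ id) ∘ resume-tagged) ∘ progress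
      simulation = trans (pullˡ +₁-swap) (trans (pullʳ progress-simulates) (sym assoc))

    module _ (g : Hom X (K Y)) where
      restrict-by-g : Hom (X × K Y) (K Y)
      restrict-by-g = restrict ∘ (g ×₁ id)

      ↓-iter-resume-tagged : (g ∘ fst) ↓ ([ id , f† ] ∘ snd) ≡ iter Y ((restrict-by-g +₁ id) ∘ resume-tagged)
      ↓-iter-resume-tagged = begin
        (g ∘ fst) ↓ ([ id , f† ] ∘ snd)                   ≡⟨ cong ((g ∘ fst) ↓_) (sym (trans (cong (iter Y) F-snd) iter-resume-tagged)) ⟩
        (g ∘ fst) ↓ iter Y ((snd +₁ id) ∘ F)              ≡⟨ ↓-iter (g ∘ fst) F F-over ⟩
        iter Y ((restrict +₁ id) ∘ F)                     ≡⟨ cong (iter Y) (pullˡ (trans +₁-∘ (cong (restrict-by-g +₁_) identityˡ))) ⟩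
        iter Y ((restrict-by-g +₁ id) ∘ resume-tagged)    ∎
        where
        F : Hom (X × (K Y + X)) ((K Y × K Y) + X × (K Y + X))
        F = (g ×₁ id +₁ id) ∘ resume-tagged
        F-snd : (snd +₁ id) ∘ F ≡ (snd +₁ id) ∘ resume-tagged
        F-snd = pullˡ (trans +₁-∘ (cong₂ _+₁_ (trans snd-β identityˡ) identityˡ))
        F-over : [ fst , g ∘ fst ] ∘ F ≡ g ∘ fst
        F-over = begin
          [ fst , g ∘ fst ] ∘ F                       ≡⟨ pullˡ (trans []-+₁ (trans (cong₂ [_,_] fst-β identityʳ) (sym []-∘))) ⟩
          (g ∘ [ fst , fst ]) ∘ (dstr ∘ (id ×₁ resume)) ≡⟨ pullʳ (pullˡ dstr-fst) ⟩
          g ∘ (fst ∘ (id ×₁ resume))                  ≡⟨ cong (g ∘_) (trans fst-β identityˡ) ⟩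
          g ∘ fst                                     ∎

      module _ {b : Hom (X × ℕ) (K Y)} (isb : IsBoundedIter Y f b) (below : Below Y b (g ∘ fst)) where
        clocked-outputs-below : (restrict-by-g +₁ id) ∘ clocked ≡ (snd +₁ id) ∘ clocked
        clocked-outputs-below = begin
          (restrict-by-g +₁ id) ∘ clocked                          ≡⟨ pullˡ (trans +₁-∘ (cong₂ _+₁_ restrict-by-g-fst identityˡ)) ⟩
          (g-start ↓ snd +₁ (id ×₁ succ) ∘ fst) ∘ case next-state      ≡⟨ case-inl-agree next-state (id ×₁ succ) outputs-below ⟩
          (snd +₁ (id ×₁ succ) ∘ fst) ∘ case next-state            ≡⟨ sym (pullˡ (trans +₁-∘ (cong₂ _+₁_ (trans snd-β identityˡ) identityˡ))) ⟩
          (snd +₁ id) ∘ clocked                                    ∎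
          where
          g-start : ∀ {B} → Hom ((X × ℕ) × B) (K Y)
          g-start = (g ∘ fst) ∘ fst

          restrict-by-g-fst : restrict-by-g ∘ (fst ×₁ id) ≡ g-start ↓ snd
          restrict-by-g-fst = trans (pullʳ (trans ×₁-∘ (cong ⟨ (g ∘ fst) ∘ fst ,_⟩ (trans (cong (_∘ snd) identityˡ) identityˡ)))) restrict-⟨⟩

          bounded-succ : bounded ∘ (id ×₁ succ) ≡ [ snd , (diverge Y ∘ !) ∘ snd ] ∘ case next-state
          bounded-succ = trans assoc (trans (cong ([ id , diverge Y ∘ ! ] ∘_) (sym case-snd)) (pullˡ (trans []-+₁ (cong₂ [_,_] identityˡ refl))))

          outputs-below : [ g-start ↓ snd , g-start ↓ ((diverge Y ∘ !) ∘ snd) ] ∘ case next-state ≡ [ snd , (diverge Y ∘ !) ∘ snd ] ∘ case next-state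
          outputs-below = begin
            [ g-start ↓ snd , g-start ↓ ((diverge Y ∘ !) ∘ snd) ] ∘ case next-state            ≡⟨ trans (cong (_∘ case next-state) ↓-[]) ↓-∘ ⟩
            ([ g-start , g-start ] ∘ case next-state) ↓ ([ snd , (diverge Y ∘ !) ∘ snd ] ∘ case next-state)
              ≡⟨ cong₂ _↓_ (trans (cong (_∘ case next-state) (sym []-∘)) (trans (pullʳ case-fst) identityʳ)) (sym bounded-succ) ⟩
            (g ∘ fst) ↓ (bounded ∘ (id ×₁ succ))                                     ≡⟨ sym below-succ ⟩
            bounded ∘ (id ×₁ succ)                                                   ≡⟨ bounded-succ ⟩
            [ snd , (diverge Y ∘ !) ∘ snd ] ∘ case next-state                         ∎
            where
            below-succ : bounded ∘ (id ×₁ succ) ≡ (g ∘ fst) ↓ (bounded ∘ (id ×₁ succ))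
            below-succ = begin
              bounded ∘ (id ×₁ succ)                                  ≡⟨ cong (_∘ (id ×₁ succ)) (trans (sym (isBoundedIter-unique isb)) (trans below (cong ((g ∘ fst) ↓_) (isBoundedIter-unique isb)))) ⟩
              ((g ∘ fst) ↓ bounded) ∘ (id ×₁ succ)                     ≡⟨ ↓-∘ ⟩
              ((g ∘ fst) ∘ (id ×₁ succ)) ↓ (bounded ∘ (id ×₁ succ))    ≡⟨ cong (_↓ (bounded ∘ (id ×₁ succ))) (pullʳ (trans fst-β identityˡ)) ⟩
              (g ∘ fst) ↓ (bounded ∘ (id ×₁ succ))                     ∎

        iter-below : Below Y f† g
        iter-below = begin
          f†                                                            ≡⟨ sym (trans (pullʳ snd-β) inr-β) ⟩
          ([ id , f† ] ∘ snd) ∘ ⟨ id , inr ⟩                             ≡⟨ cong (_∘ ⟨ id , inr ⟩) (sym iter-resume-tagged) ⟩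
          iter Y ((snd +₁ id) ∘ resume-tagged) ∘ ⟨ id , inr ⟩            ≡⟨ iter-resume-tagged-start snd ⟩
          iter Y ((snd +₁ id) ∘ clocked) ∘ ⟨ id , zero ∘ ! ⟩             ≡⟨ cong (λ z → iter Y z ∘ ⟨ id , zero ∘ ! ⟩) (sym clocked-outputs-below) ⟩
          iter Y ((restrict-by-g +₁ id) ∘ clocked) ∘ ⟨ id , zero ∘ ! ⟩   ≡⟨ sym (iter-resume-tagged-start restrict-by-g) ⟩
          iter Y ((restrict-by-g +₁ id) ∘ resume-tagged) ∘ ⟨ id , inr ⟩  ≡⟨ cong (_∘ ⟨ id , inr ⟩) (sym ↓-iter-resume-tagged) ⟩
          ((g ∘ fst) ↓ ([ id , f† ] ∘ snd)) ∘ ⟨ id , inr ⟩               ≡⟨ trans ↓-∘ (cong₂ _↓_ (trans (pullʳ fst-β) identityʳ) (trans (pullʳ snd-β) inr-β)) ⟩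
          g ↓ f†                                                        ∎

theorem5p15 : ∀ {o h : Level} {C : Category o h} (S : Standing C) (H : Theory.Hypotheses S) →
    let open Theory S in let open WithHyp H in
    ∀ {X Y : Obj} (f : Hom X (K Y + X)) (g : Hom X (K Y)) (b : Hom (X × ℕ) (K Y)) →
    IsBoundedIter Y f b →
    Below Y b (iter Y f ∘ fst) ∧ (Below Y b (g ∘ fst) → Below Y (iter Y f) g)
theorem5p15 S H f g b isb = isBoundedIter-below-iter f isb ,, iter-below f g isb
  where open BoundedIteration S H
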